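{- Let $G$ be a bridgeless cubic graph and let $\mathcal T=(M_1,M_2,M_3)$ be an FR-triple of $G$. Then $\overline{G_{T_2}}$ is $3$-edge colourable.
   Context: An FR-triple of $G$ is an ordered triple $(M_1,M_2,M_3)$ of perfect matchings of $G$ with $M_1\cap M_2\cap M_3=\emptyset$; $T_i$ ($i=0,1,2$) is the set of edges contained in exactly $i$ of $M_1,M_2,M_3$. For an FR-triple, every vertex incident with an edge of $T_2$ is incident with exactly one edge of $T_0$ and exactly one edge of $T_1$, and every vertex incident with an edge of $T_0$ is incident with exactly one edge of $T_2$; thus $T_0\cup T_2$ is a union of vertex-disjoint cycles alternating between $T_2$ and $T_0$. Splitting: $G_{T_2}$ is obtained from $G$ as follows: for every edge $ab\in T_2$, replace $a$ by two new vertices $a^1$ (incident with the $T_1$-edge formerly at $a$) and $a^0$ (incident with the $T_0$-edge formerly at $a$), replace $b$ likewise by $b^1,b^0$, and replace the edge $ab$ by the two edges $a^1b^1$ and $a^0b^0$. The resulting graph has vertices of degree $3$ and $2$. $\overline{G_{T_2}}$ is obtained from $G_{T_2}$ by suppressing the degree-$2$ vertices: every maximal path whose internal vertices have degree $2$ is replaced by a single edge, and every cycle all of whose vertices have degree $2$ is replaced by a vertexless loop (a component consisting of one edge and no vertex). The components of $\overline{G_{T_2}}$ are cubic (multi)graphs and vertexless loops; $\overline{G_{T_2}}$ is called $3$-edge colourable if each of its cubic components is $3$-edge colourable (vertexless loops may receive any colour). -}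

module Defs where

open import Data.Bool using (Bool; true; false; not; _∨_; _∧_; if_then_else_; T)
open import Data.Nat using (ℕ; _+_; _≡ᵇ_)
open import Data.Fin using (Fin; _≟_)
open import Data.List using (allFin)
open import Data.Bool.ListAction using (any)
open import Data.Product using (Σ; _×_; _,_; proj₁; proj₂)
open import Relation.Binary.PropositionalEquality using (_≡_)
open import Relation.Nullary using (¬_; does)
open import Function.Bundles using (_↔_)

-- Multigraphs (parallel edges and loops allowed).
-- A graph with vertex type V and edge type E is given by
-- end : E → Bool → V, the two ends of each edge.

Dart : Set → Set
Dart E = E × Bool

module _ {V E : Set} (end : E → Bool → V) where

  vtx : Dart E → V
  vtx (e , b) = end e b

  flip : Dart E → Dart E
  flip (e , b) = e , not b

  -- v has degree k: exactly k edge-ends at v (a loop counts twice)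
  HasDegree : V → ℕ → Set
  HasDegree v k = Fin k ↔ Σ (Dart E) (λ d → vtx d ≡ v)

  Cubic : Set
  Cubic = ∀ v → HasDegree v 3

  data ConnAvoiding (f : E) : V → V → Set where
    stay : ∀ {u} → ConnAvoiding f u u
    step : ∀ {v} (g : E) (b : Bool) → ¬ g ≡ f →
           ConnAvoiding f (end g (not b)) v → ConnAvoiding f (end g b) v

  Bridgeless : Set
  Bridgeless = ∀ e → ConnAvoiding e (end e false) (end e true)

  PerfectMatching : (E → Bool) → Set
  PerfectMatching M =
    ∀ v → Fin 1 ↔ Σ (Dart E) (λ d → vtx d ≡ v × M (proj₁ d) ≡ true)

  FRTriple : (M₁ M₂ M₃ : E → Bool) → Set
  FRTriple M₁ M₂ M₃ =
    PerfectMatching M₁ × PerfectMatching M₂ × PerfectMatching M₃ ×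
    (∀ e → ¬ (M₁ e ≡ true × M₂ e ≡ true × M₃ e ≡ true))

  -- Thread x y : leaving vertex (vtx x) along the dart x and passing
  -- through degree-2 vertices only, one arrives at a degree-3 vertex
  -- through the dart y.  The maximal paths with degree-2 interior between
  -- degree-3 vertices (the edges of the suppressed graph) are exactly
  -- these threads; the half-edges of the suppressed graph are the darts
  -- at degree-3 vertices, and Thread pairs up the two half-edges of each
  -- new edge.  Cycles consisting of degree-2 vertices only (which become
  -- vertexless loops) contain no such dart and impose no constraint.
  data Thread : Dart E → Dart E → Set where
    arrive : ∀ {x} → HasDegree (vtx (flip x)) 3 → Thread x (flip x)
    pass   : ∀ {x y} (z : Dart E) → HasDegree (vtx (flip x)) 2 →
             vtx z ≡ vtx (flip x) → ¬ z ≡ flip x → Thread z y → Thread x y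

  -- The graph obtained by suppressing all degree-2 vertices is
  -- 3-edge colourable: there is a colouring of its half-edges with three
  -- colours that is constant on each (suppressed) edge and injective on
  -- the half-edges at each (degree-3) vertex.
  SuppressedThreeEdgeColourable : Set
  SuppressedThreeEdgeColourable =
    Σ (Dart E → Fin 3) λ c →
      (∀ x y → HasDegree (vtx x) 3 → Thread x y → c x ≡ c y) ×
      (∀ x y → HasDegree (vtx x) 3 → vtx x ≡ vtx y → c x ≡ c y → x ≡ y)

bool→ℕ : Bool → ℕ
bool→ℕ true  = 1
bool→ℕ false = 0

-- number of the M_i containing e; e ∈ T_i iff mult e ≡ i
mult : ∀ {E : Set} (M₁ M₂ M₃ : E → Bool) → E → ℕ
mult M₁ M₂ M₃ e = bool→ℕ (M₁ e) + bool→ℕ (M₂ e) + bool→ℕ (M₃ e)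

private
  fixT : (t r : Bool) → T (t ∨ (r ∨ not t))
  fixT true  r = _
  fixT false r with r
  ... | true  = _
  ... | false = _

-- The split graph G_{T₂} of G = (Fin n, Fin m, end).
-- Vertices: (v , true) for every v; additionally (v , false) when v is
-- incident with a T₂-edge.  For such v, (v , true) = v¹ and
-- (v , false) = v⁰.
-- Edges: (e , true) for every e; additionally (e , false) when e ∈ T₂.
-- For e = ab ∈ T₂, (e , true) = a¹b¹ and (e , false) = a⁰b⁰.
-- A T₁-edge at a T₂-vertex a is attached to a¹, a T₀-edge to a⁰.

module Split {n m : ℕ} (end : Fin m → Bool → Fin n) (M₁ M₂ M₃ : Fin m → Bool) where

  inT : ℕ → Fin m → Bool
  inT i e = mult M₁ M₂ M₃ e ≡ᵇ i

  touchesT₂ : Fin n → Bool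
  touchesT₂ v = any (λ e → inT 2 e ∧ (does (end e false ≟ v) ∨ does (end e true ≟ v))) (allFin m)

  V' : Set
  V' = Σ (Fin n × Bool) (λ p → T (touchesT₂ (proj₁ p) ∨ proj₂ p))

  E' : Set
  E' = Σ (Fin m × Bool) (λ p → T (inT 2 (proj₁ p) ∨ proj₂ p))

  end' : E' → Bool → V'
  end' ((e , c) , _) s = (a , (raw ∨ not (touchesT₂ a))) , fixT (touchesT₂ a) raw
    where
      a : Fin n
      a = end e s
      raw : Bool
      raw = if inT 2 e then c else inT 1 e

module Submission where

-- Colour an edge of T₁ by the index of the one matching containing it, an edge of T₂ by the
-- index of the one matching missing it, and every edge of G_{T₂} by the colour of the edge of G
-- it comes from.  In a cubic graph a vertex meeting no T₂-edge sees only T₁-edges (a T₀-edge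
-- there would be a fourth dart besides the three distinct matching darts), while a vertex a
-- meeting a T₂-edge splits into a¹ and a⁰ of degree 2.  So the degree-3 vertices of G_{T₂} are
-- the vertices untouched by T₂, and their three colours are distinct because each Mᵢ is a
-- perfect matching.  A suppressed edge leaving such a vertex runs along T₁-edges and copies
-- a¹b¹ only, and at a¹ the T₁-edge lies in the matching that the T₂-edge misses, so the colour
-- is constant along it.

open import Defs
open import Data.Bool using (Bool; true; false; not; _∨_; _∧_; if_then_else_; T)
open import Data.Bool.Properties using (T-≡; T-∨; T-irrelevant; ∨-identityʳ; ∨-zeroʳ)
open import Data.Nat using (ℕ; _+_; _≤_; _≡ᵇ_)
open import Data.Nat.Properties using (≡ᵇ⇒≡; n≮n)
open import Data.Fin using (Fin; _≟_; punchOut)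
open import Data.Fin.Patterns using (0F; 1F; 2F)
open import Data.Fin.Properties using (injective⇒≤; punchOut-injective)
open import Data.List using (allFin)
open import Data.List.Membership.Propositional using (lose)
open import Data.List.Membership.Propositional.Properties using (∈-allFin)
open import Data.List.Relation.Unary.Any using (satisfied)
open import Data.List.Relation.Unary.Any.Properties using (any⁺; any⁻)
open import Data.Product using (Σ; ∃-syntax; _×_; _,_; proj₁; proj₂)
open import Data.Product.Properties using (≡-dec)
open import Data.Sum using (_⊎_; inj₁; inj₂)
open import Function using (_∘_)
open import Function.Bundles using (Inverse; Injection; Equivalence)
open import Function.Properties.Inverse using (↔⇒↣; ↔-sym)
open import Relation.Binary.PropositionalEquality
open import Relation.Nullary using (¬_; Dec; yes; no; does; contradiction)
open import Relation.Nullary.Decidable using (dec-true)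
import Data.Bool.Properties as Bool

Fin1-≡ : (i j : Fin 1) → i ≡ j
Fin1-≡ 0F 0F = refl

Fin3-avoid-two-unique : ∀ {a b i j : Fin 3} → a ≢ b →
  i ≢ a → i ≢ b → j ≢ a → j ≢ b → i ≡ j
Fin3-avoid-two-unique {a} {b} {i} {j} a≢b i≢a i≢b j≢a j≢b =
  punchOut-injective a≢i a≢j
    (punchOut-injective (i′≢b′ ∘ sym) (j′≢b′ ∘ sym) (Fin1-≡ _ _))
  where
    a≢i : a ≢ i
    a≢i = i≢a ∘ sym
    a≢j : a ≢ j
    a≢j = j≢a ∘ sym
    i′≢b′ : punchOut a≢i ≢ punchOut a≢b
    i′≢b′ = i≢b ∘ punchOut-injective a≢i a≢b
    j′≢b′ : punchOut a≢j ≢ punchOut a≢b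
    j′≢b′ = j≢b ∘ punchOut-injective a≢j a≢b

Fin3-avoid-two : (a b : Fin 3) → ∃[ l ] (l ≢ a × l ≢ b)
Fin3-avoid-two 0F 0F = 1F , (λ ()) , (λ ())
Fin3-avoid-two 0F 1F = 2F , (λ ()) , (λ ())
Fin3-avoid-two 0F 2F = 1F , (λ ()) , (λ ())
Fin3-avoid-two 1F 0F = 2F , (λ ()) , (λ ())
Fin3-avoid-two 1F 1F = 0F , (λ ()) , (λ ())
Fin3-avoid-two 1F 2F = 0F , (λ ()) , (λ ())
Fin3-avoid-two 2F 0F = 1F , (λ ()) , (λ ())
Fin3-avoid-two 2F 1F = 0F , (λ ()) , (λ ())
Fin3-avoid-two 2F 2F = 0F , (λ ()) , (λ ())

module _ {V E : Set} (end : E → Bool → V) where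

  private
    at-≡ : ∀ {v d d′} {p : vtx end d ≡ v} {p′ : vtx end d′ ≡ v} →
           d ≡ d′ → _≡_ {A = Σ (Dart E) (λ x → vtx end x ≡ v)} (d , p) (d′ , p′)
    at-≡ {p = refl} {refl} refl = refl

  module _ {v : V} {k : ℕ} (deg : HasDegree end v k) where

    index : (d : Dart E) → vtx end d ≡ v → Fin k
    index d p = Inverse.from deg (d , p)

    index-injective : ∀ {d d′ p p′} → index d p ≡ index d′ p′ → d ≡ d′
    index-injective eq = cong proj₁ (Injection.injective (↔⇒↣ (↔-sym deg)) eq)

    listed : Fin k → Dart E
    listed i = proj₁ (Inverse.to deg i)

    listed-at : ∀ i → vtx end (listed i) ≡ v
    listed-at i = proj₂ (Inverse.to deg i)

    listed-injective : ∀ {i j} → listed i ≡ listed j → i ≡ j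
    listed-injective eq = Injection.injective (↔⇒↣ deg) (at-≡ eq)

    ≤-degree : ∀ {j} (g : Fin j → Dart E) → (∀ i → vtx end (g i) ≡ v) →
               (∀ {i i′} → g i ≡ g i′ → i ≡ i′) → j ≤ k
    ≤-degree g g-at g-injective =
      injective⇒≤ {f = λ i → index (g i) (g-at i)} (g-injective ∘ index-injective)

    degree-≤ : ∀ {j} (h : Dart E → Fin j) →
               (∀ {x y} → vtx end x ≡ v → vtx end y ≡ v → h x ≡ h y → x ≡ y) → k ≤ j
    degree-≤ h h-injective = injective⇒≤ {f = h ∘ listed}
      (listed-injective ∘ h-injective (listed-at _) (listed-at _))

  third-dart-unique : ∀ {v a b x y} → HasDegree end v 3 →
    vtx end a ≡ v → vtx end b ≡ v → vtx end x ≡ v → vtx end y ≡ v →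
    a ≢ b → x ≢ a → x ≢ b → y ≢ a → y ≢ b → x ≡ y
  third-dart-unique deg a-at b-at x-at y-at a≢b x≢a x≢b y≢a y≢b =
    ι {p = x-at} {p′ = y-at}
      (Fin3-avoid-two-unique {index deg _ a-at} {index deg _ b-at}
        (a≢b ∘ ι) (x≢a ∘ ι) (x≢b ∘ ι) (y≢a ∘ ι) (y≢b ∘ ι))
    where
      ι : ∀ {d d′ p p′} → index deg d p ≡ index deg d′ p′ → d ≡ d′
      ι = index-injective deg

  module _ {M : E → Bool} (perfect : PerfectMatching end M) where

    matched : (v : V) → Σ (Dart E) (λ d → vtx end d ≡ v × M (proj₁ d) ≡ true)
    matched v = Inverse.to (perfect v) 0F

    matched-unique : ∀ {d d′} → vtx end d ≡ vtx end d′ →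
                     M (proj₁ d) ≡ true → M (proj₁ d′) ≡ true → d ≡ d′
    matched-unique {d} {d′} same m m′ = cong proj₁
      (Injection.injective (↔⇒↣ (↔-sym (perfect (vtx end d′))))
        {d , same , m} {d′ , refl , m′} (Fin1-≡ _ _))

T-∨-false : ∀ {x y} → x ≡ false → T (x ∨ y) → y ≡ true
T-∨-false refl = Equivalence.to T-≡

count : Bool → Bool → Bool → ℕ
count a b c = bool→ℕ a + bool→ℕ b + bool→ℕ c

pick : Fin 3 → Bool → Bool → Bool → Bool
pick 0F a _ _ = a
pick 1F _ b _ = b
pick 2F _ _ c = c

-- The position whose entry differs from the other two (junk on constant triples).
oddOneOut : Bool → Bool → Bool → Fin 3
oddOneOut true  false false = 0F
oddOneOut false true  true  = 0F
oddOneOut false true  false = 1F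
oddOneOut true  false true  = 1F
oddOneOut _     _     _     = 2F

count-cases : ∀ a b c → count a b c ≡ 0 ⊎ count a b c ≡ 1 ⊎ count a b c ≡ 2 ⊎
                        (a ≡ true × b ≡ true × c ≡ true)
count-cases false false false = inj₁ refl
count-cases true  false false = inj₂ (inj₁ refl)
count-cases false true  false = inj₂ (inj₁ refl)
count-cases false false true  = inj₂ (inj₁ refl)
count-cases true  true  false = inj₂ (inj₂ (inj₁ refl))
count-cases true  false true  = inj₂ (inj₂ (inj₁ refl))
count-cases false true  true  = inj₂ (inj₂ (inj₁ refl))
count-cases true  true  true  = inj₂ (inj₂ (inj₂ (refl , refl , refl)))

count≡0⇒¬pick : ∀ a b c l → count a b c ≡ 0 → pick l a b c ≡ false
count≡0⇒¬pick false false false 0F refl = refl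
count≡0⇒¬pick false false false 1F refl = refl
count≡0⇒¬pick false false false 2F refl = refl
count≡0⇒¬pick true  _     _     _  ()
count≡0⇒¬pick false true  _     _  ()
count≡0⇒¬pick false false true  _  ()

count≡1⇒pick-oddOneOut : ∀ a b c → count a b c ≡ 1 → pick (oddOneOut a b c) a b c ≡ true
count≡1⇒pick-oddOneOut true  false false refl = refl
count≡1⇒pick-oddOneOut false true  false refl = refl
count≡1⇒pick-oddOneOut false false true  refl = refl
count≡1⇒pick-oddOneOut true  true  _     ()
count≡1⇒pick-oddOneOut true  false true  ()
count≡1⇒pick-oddOneOut false true  true  ()
count≡1⇒pick-oddOneOut false false false ()

count≡1⇒pick⇒oddOneOut : ∀ a b c l → count a b c ≡ 1 → pick l a b c ≡ true → l ≡ oddOneOut a b c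
count≡1⇒pick⇒oddOneOut true  false false 0F refl refl = refl
count≡1⇒pick⇒oddOneOut false true  false 1F refl refl = refl
count≡1⇒pick⇒oddOneOut false false true  2F refl refl = refl
count≡1⇒pick⇒oddOneOut true  false false 1F refl ()
count≡1⇒pick⇒oddOneOut true  false false 2F refl ()
count≡1⇒pick⇒oddOneOut false true  false 0F refl ()
count≡1⇒pick⇒oddOneOut false true  false 2F refl ()
count≡1⇒pick⇒oddOneOut false false true  0F refl ()
count≡1⇒pick⇒oddOneOut false false true  1F refl ()
count≡1⇒pick⇒oddOneOut true  true  _     _  ()
count≡1⇒pick⇒oddOneOut true  false true  _  ()
count≡1⇒pick⇒oddOneOut false true  true  _  ()
count≡1⇒pick⇒oddOneOut false false false _  ()

count≡2⇒pick : ∀ a b c l → count a b c ≡ 2 → l ≢ oddOneOut a b c → pick l a b c ≡ true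
count≡2⇒pick true  true  false 0F refl _ = refl
count≡2⇒pick true  true  false 1F refl _ = refl
count≡2⇒pick true  false true  0F refl _ = refl
count≡2⇒pick true  false true  2F refl _ = refl
count≡2⇒pick false true  true  1F refl _ = refl
count≡2⇒pick false true  true  2F refl _ = refl
count≡2⇒pick true  true  false 2F refl l≢odd = contradiction refl l≢odd
count≡2⇒pick true  false true  1F refl l≢odd = contradiction refl l≢odd
count≡2⇒pick false true  true  0F refl l≢odd = contradiction refl l≢odd
count≡2⇒pick true  true  true  _  ()
count≡2⇒pick true  false false _  ()
count≡2⇒pick false true  false _  ()
count≡2⇒pick false false true  _  ()
count≡2⇒pick false false false _  ()

count≡2⇒¬pick-oddOneOut : ∀ a b c → count a b c ≡ 2 → pick (oddOneOut a b c) a b c ≡ false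
count≡2⇒¬pick-oddOneOut true  true  false refl = refl
count≡2⇒¬pick-oddOneOut true  false true  refl = refl
count≡2⇒¬pick-oddOneOut false true  true  refl = refl
count≡2⇒¬pick-oddOneOut true  true  true  ()
count≡2⇒¬pick-oddOneOut true  false false ()
count≡2⇒¬pick-oddOneOut false true  false ()
count≡2⇒¬pick-oddOneOut false false true  ()
count≡2⇒¬pick-oddOneOut false false false ()

module _ {n m : ℕ} (end : Fin m → Bool → Fin n) (cubic : Cubic end)
         (M₁ M₂ M₃ : Fin m → Bool) (fr : FRTriple end M₁ M₂ M₃) where

  open Split end M₁ M₂ M₃

  M : Fin 3 → Fin m → Bool
  M l e = pick l (M₁ e) (M₂ e) (M₃ e)

  μ : Fin m → ℕ
  μ = mult M₁ M₂ M₃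

  colour : Fin m → Fin 3
  colour e = oddOneOut (M₁ e) (M₂ e) (M₃ e)

  M-perfect : ∀ l → PerfectMatching end (M l)
  M-perfect 0F = proj₁ fr
  M-perfect 1F = proj₁ (proj₂ fr)
  M-perfect 2F = proj₁ (proj₂ (proj₂ fr))

  μ-cases : ∀ e → μ e ≡ 0 ⊎ μ e ≡ 1 ⊎ μ e ≡ 2
  μ-cases e with count-cases (M₁ e) (M₂ e) (M₃ e)
  ... | inj₁ t₀                 = inj₁ t₀
  ... | inj₂ (inj₁ t₁)          = inj₂ (inj₁ t₁)
  ... | inj₂ (inj₂ (inj₁ t₂))   = inj₂ (inj₂ t₂)
  ... | inj₂ (inj₂ (inj₂ in-all)) = contradiction in-all (proj₂ (proj₂ (proj₂ fr)) e)

  T₀-unmatched : ∀ {e} l → μ e ≡ 0 → M l e ≡ false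
  T₀-unmatched {e} l = count≡0⇒¬pick (M₁ e) (M₂ e) (M₃ e) l

  T₁-matched : ∀ {e} → μ e ≡ 1 → M (colour e) e ≡ true
  T₁-matched {e} = count≡1⇒pick-oddOneOut (M₁ e) (M₂ e) (M₃ e)

  T₁-matched-only : ∀ {e l} → μ e ≡ 1 → M l e ≡ true → l ≡ colour e
  T₁-matched-only {e} {l} = count≡1⇒pick⇒oddOneOut (M₁ e) (M₂ e) (M₃ e) l

  T₂-matched : ∀ {e l} → μ e ≡ 2 → l ≢ colour e → M l e ≡ true
  T₂-matched {e} {l} = count≡2⇒pick (M₁ e) (M₂ e) (M₃ e) l

  T₂-unmatched : ∀ {e} → μ e ≡ 2 → M (colour e) e ≡ false
  T₂-unmatched {e} = count≡2⇒¬pick-oddOneOut (M₁ e) (M₂ e) (M₃ e)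

  matched-twice⇒T₂ : ∀ {e l l′} → l ≢ l′ → M l e ≡ true → M l′ e ≡ true → μ e ≡ 2
  matched-twice⇒T₂ {e} {l} l≢l′ m m′ with μ-cases e
  ... | inj₁ t₀        = contradiction (trans (sym m) (T₀-unmatched l t₀)) λ ()
  ... | inj₂ (inj₁ t₁) =
    contradiction (trans (T₁-matched-only t₁ m) (sym (T₁-matched-only t₁ m′))) l≢l′
  ... | inj₂ (inj₂ t₂) = t₂

  D : Set
  D = Dart (Fin m)

  ≢-by-μ : ∀ {d d′ : D} {i j} → μ (proj₁ d) ≡ i → μ (proj₁ d′) ≡ j → i ≢ j → d ≢ d′
  ≢-by-μ refl refl i≢j = i≢j ∘ cong (μ ∘ proj₁)

  ≢-by-M : ∀ {l} {d d′ : D} → M l (proj₁ d) ≡ false → M l (proj₁ d′) ≡ true → d ≢ d′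
  ≢-by-M m m′ refl = contradiction (trans (sym m) m′) λ ()

  touchesT₂-intro : ∀ {d : D} {v} → vtx end d ≡ v → μ (proj₁ d) ≡ 2 → touchesT₂ v ≡ true
  touchesT₂-intro {e , s} refl t₂ =
    Equivalence.to T-≡ (any⁺ _ (lose (∈-allFin e) (Equivalence.from T-≡ incident)))
    where
      incident : (inT 2 e ∧ (does (end e false ≟ end e s) ∨ does (end e true ≟ end e s))) ≡ true
      incident = cong₂ _∧_ (cong (_≡ᵇ 2) t₂) (ends s)
        where
          ends : ∀ s → (does (end e false ≟ end e s) ∨ does (end e true ≟ end e s)) ≡ true
          ends false = cong (_∨ does (end e true ≟ end e false))
                            (dec-true (end e false ≟ end e false) refl)
          ends true  = trans (cong (does (end e false ≟ end e true) ∨_)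
                                   (dec-true (end e true ≟ end e true) refl))
                             (∨-zeroʳ _)

  touchesT₂-elim : ∀ {v} → touchesT₂ v ≡ true → Σ D (λ d → vtx end d ≡ v × μ (proj₁ d) ≡ 2)
  touchesT₂-elim {v} touched
    with satisfied (any⁻ _ (allFin m) (Equivalence.from T-≡ touched))
  -- In the omitted cases the type of incident reduces to ⊥.
  ... | e , incident with inT 2 e in t₂ | end e false ≟ v | end e true ≟ v
  ...   | true | yes p | _     = (e , false) , p , ≡ᵇ⇒≡ (μ e) 2 (Equivalence.from T-≡ t₂)
  ...   | true | no _  | yes q = (e , true) , q , ≡ᵇ⇒≡ (μ e) 2 (Equivalence.from T-≡ t₂)

  untouched-no-T₂ : ∀ {d : D} {v} → touchesT₂ v ≡ false → vtx end d ≡ v → μ (proj₁ d) ≢ 2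
  untouched-no-T₂ untouched d-at t₂ =
    contradiction (trans (sym (touchesT₂-intro d-at t₂)) untouched) λ ()

  T₂-dart-unique : ∀ {d d′ : D} → vtx end d ≡ vtx end d′ →
                   μ (proj₁ d) ≡ 2 → μ (proj₁ d′) ≡ 2 → d ≡ d′
  T₂-dart-unique {d} {d′} same t₂ t₂′
    with Fin3-avoid-two (colour (proj₁ d)) (colour (proj₁ d′))
  ... | l , l≢c , l≢c′ = matched-unique end (M-perfect l) same (T₂-matched t₂ l≢c) (T₂-matched t₂′ l≢c′)

  T₁-colour-at-T₂-vertex : ∀ {d df : D} → vtx end d ≡ vtx end df →
    μ (proj₁ d) ≡ 1 → μ (proj₁ df) ≡ 2 → colour (proj₁ d) ≡ colour (proj₁ df)
  T₁-colour-at-T₂-vertex {d} {df} same t₁ t₂ with colour (proj₁ d) ≟ colour (proj₁ df)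
  ... | yes c≡c′ = c≡c′
  ... | no  c≢c′ = contradiction
    (matched-unique end (M-perfect (colour (proj₁ d))) same (T₁-matched t₁) (T₂-matched t₂ c≢c′))
    (≢-by-μ t₁ t₂ λ ())

  colour-at-T₂-vertex : ∀ {d df : D} → vtx end d ≡ vtx end df →
    μ (proj₁ d) ≡ 1 ⊎ μ (proj₁ d) ≡ 2 → μ (proj₁ df) ≡ 2 → colour (proj₁ d) ≡ colour (proj₁ df)
  colour-at-T₂-vertex same (inj₁ t₁) t₂ = T₁-colour-at-T₂-vertex same t₁ t₂
  colour-at-T₂-vertex same (inj₂ t₂) t₂′ = cong (colour ∘ proj₁) (T₂-dart-unique same t₂ t₂′)

  T₁-dart-unique-at-T₂-vertex : ∀ {d d′ df : D} → vtx end d ≡ vtx end df → vtx end d′ ≡ vtx end df →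
    μ (proj₁ d) ≡ 1 → μ (proj₁ d′) ≡ 1 → μ (proj₁ df) ≡ 2 → d ≡ d′
  T₁-dart-unique-at-T₂-vertex {d} {d′} {df} d-at d′-at t₁ t₁′ t₂ =
    matched-unique end (M-perfect (colour (proj₁ df))) (trans d-at (sym d′-at))
      (subst (λ l → M l (proj₁ d) ≡ true) (T₁-colour-at-T₂-vertex d-at t₁ t₂) (T₁-matched t₁))
      (subst (λ l → M l (proj₁ d′) ≡ true) (T₁-colour-at-T₂-vertex d′-at t₁′ t₂) (T₁-matched t₁′))

  -- At a T₂-vertex the darts are the T₂-dart, the dart of the matching missing it, and one more.
  T₀-dart-unique-at-T₂-vertex : ∀ {d d′ df : D} → vtx end d ≡ vtx end df → vtx end d′ ≡ vtx end df →
    μ (proj₁ d) ≡ 0 → μ (proj₁ d′) ≡ 0 → μ (proj₁ df) ≡ 2 → d ≡ d′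
  T₀-dart-unique-at-T₂-vertex {d} {d′} {df} d-at d′-at t₀ t₀′ t₂
    with matched end (M-perfect (colour (proj₁ df))) (vtx end df)
  ... | b , b-at , b-in = third-dart-unique end (cubic _) refl b-at d-at d′-at
    (≢-by-M (T₂-unmatched t₂) b-in) (≢-by-μ t₀ t₂ λ ()) (≢-by-M (T₀-unmatched _ t₀) b-in)
    (≢-by-μ t₀′ t₂ λ ()) (≢-by-M (T₀-unmatched _ t₀′) b-in)

  untouched⇒T₁ : ∀ {d : D} {v} → touchesT₂ v ≡ false → vtx end d ≡ v → μ (proj₁ d) ≡ 1
  untouched⇒T₁ {d} {v} untouched d-at with μ-cases (proj₁ d)
  ... | inj₂ (inj₁ t₁) = t₁
  ... | inj₂ (inj₂ t₂) = contradiction t₂ (untouched-no-T₂ untouched d-at)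
  ... | inj₁ t₀ = contradiction
    (third-dart-unique end (cubic v) (mate-at 0F) (mate-at 1F) d-at (mate-at 2F)
      (distinct 0F 1F λ ()) (unmatched 0F) (unmatched 1F) (distinct 2F 0F λ ()) (distinct 2F 1F λ ()))
    (unmatched 2F)
    where
      mate : Fin 3 → D
      mate l = proj₁ (matched end (M-perfect l) v)
      mate-at : ∀ l → vtx end (mate l) ≡ v
      mate-at l = proj₁ (proj₂ (matched end (M-perfect l) v))
      mate-in : ∀ l → M l (proj₁ (mate l)) ≡ true
      mate-in l = proj₂ (proj₂ (matched end (M-perfect l) v))
      unmatched : ∀ l → d ≢ mate l
      unmatched l = ≢-by-M (T₀-unmatched l t₀) (mate-in l)
      distinct : ∀ l l′ → l ≢ l′ → mate l ≢ mate l′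
      distinct l l′ l≢l′ same = untouched-no-T₂ untouched (mate-at l)
        (matched-twice⇒T₂ l≢l′ (mate-in l)
          (subst (λ x → M l′ (proj₁ x) ≡ true) (sym same) (mate-in l′)))

  SplitDart : Set
  SplitDart = Dart E'

  edge : SplitDart → Fin m
  edge x = proj₁ (proj₁ (proj₁ x))

  copy : SplitDart → Bool
  copy x = proj₂ (proj₁ (proj₁ x))

  dart : SplitDart → D
  dart x = edge x , proj₂ x

  vertex : SplitDart → V'
  vertex = vtx end'

  base : V' → Fin n
  base w = proj₁ (proj₁ w)

  side : V' → Bool
  side w = proj₂ (proj₁ w)

  vertex-≡ : ∀ {w w′ : V'} → proj₁ w ≡ proj₁ w′ → w ≡ w′
  vertex-≡ {_ , p} {_ , p′} refl = cong (_ ,_) (T-irrelevant p p′)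

  side-T₁ : ∀ x → μ (edge x) ≡ 1 → side (vertex x) ≡ true
  side-T₁ x t₁ = cong₂ (λ b c → (if b then copy x else c) ∨ not (touchesT₂ (base (vertex x))))
                       (cong (_≡ᵇ 2) t₁) (cong (_≡ᵇ 1) t₁)

  side-T₂ : ∀ x → μ (edge x) ≡ 2 → side (vertex x) ≡ copy x
  side-T₂ x t₂ = trans
    (cong₂ (λ b t → (if b then copy x else inT 1 (edge x)) ∨ not t)
           (cong (_≡ᵇ 2) t₂) (touchesT₂-intro {dart x} refl t₂))
    (∨-identityʳ (copy x))

  side-T₀ : ∀ x → μ (edge x) ≡ 0 → touchesT₂ (base (vertex x)) ≡ true → side (vertex x) ≡ false
  side-T₀ x t₀ touched = trans
    (cong₂ (λ b c → (if b then copy x else c) ∨ not (touchesT₂ (base (vertex x))))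
           (cong (_≡ᵇ 2) t₀) (cong (_≡ᵇ 1) t₀))
    (cong not touched)

  unsplit-copy : ∀ x → inT 2 (edge x) ≡ false → copy x ≡ true
  unsplit-copy x ¬T₂ = T-∨-false ¬T₂ (proj₂ (proj₁ x))

  copy-determined : ∀ {x x′} → edge x ≡ edge x′ → vertex x ≡ vertex x′ → copy x ≡ copy x′
  copy-determined {x} {x′} refl same with μ-cases (edge x)
  ... | inj₂ (inj₂ t₂) = trans (sym (side-T₂ x t₂)) (trans (cong side same) (side-T₂ x′ t₂))
  ... | inj₁ t₀        =
    trans (unsplit-copy x (cong (_≡ᵇ 2) t₀)) (sym (unsplit-copy x′ (cong (_≡ᵇ 2) t₀)))
  ... | inj₂ (inj₁ t₁) =
    trans (unsplit-copy x (cong (_≡ᵇ 2) t₁)) (sym (unsplit-copy x′ (cong (_≡ᵇ 2) t₁)))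

  split-dart-≡ : ∀ {x x′} → dart x ≡ dart x′ → vertex x ≡ vertex x′ → x ≡ x′
  split-dart-≡ {((e , c) , p) , s} {((.e , c′) , p′) , .s} refl same
    with copy-determined {((e , c) , p) , s} {((e , c′) , p′) , s} refl same
  ... | refl = cong (λ q → ((e , c) , q) , s) (T-irrelevant p p′)

  lift : D → SplitDart
  lift (e , s) = ((e , true) , Equivalence.from (T-∨ {inT 2 e}) (inj₂ _)) , s

  untouched⇒¬degree-2 : ∀ {w} → touchesT₂ (base w) ≡ false → ¬ HasDegree end' w 2
  untouched⇒¬degree-2 {w@((u , b) , pw)} untouched deg =
    n≮n 2 (≤-degree end' deg (lift ∘ listed end (cubic u)) lifted-at
          (listed-injective end (cubic u) ∘ cong dart))
    where
      lifted-at : ∀ i → vertex (lift (listed end (cubic u) i)) ≡ w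
      lifted-at i = vertex-≡ (cong₂ _,_ (listed-at end (cubic u) i)
        (trans (side-T₁ (lift (listed end (cubic u) i)) (untouched⇒T₁ untouched (listed-at end (cubic u) i)))
               (sym (T-∨-false untouched pw))))

  -- The side of a T₂-vertex separates its T₁-dart from its T₀-dart.
  off-T₂-dart-unique : ∀ {x y df} → vtx end (dart x) ≡ vtx end df → vtx end (dart y) ≡ vtx end df →
    side (vertex x) ≡ side (vertex y) → μ (proj₁ df) ≡ 2 → dart x ≢ df → dart y ≢ df → dart x ≡ dart y
  off-T₂-dart-unique {x} {y} {df} x-at y-at same-side t₂ x≢df y≢df
    with μ-cases (edge x) | μ-cases (edge y)
  ... | inj₂ (inj₂ t₂x) | _              = contradiction (T₂-dart-unique x-at t₂x t₂) x≢df
  ... | _              | inj₂ (inj₂ t₂y) = contradiction (T₂-dart-unique y-at t₂y t₂) y≢df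
  ... | inj₂ (inj₁ t₁x) | inj₂ (inj₁ t₁y) = T₁-dart-unique-at-T₂-vertex x-at y-at t₁x t₁y t₂
  ... | inj₁ t₀x       | inj₁ t₀y       = T₀-dart-unique-at-T₂-vertex x-at y-at t₀x t₀y t₂
  ... | inj₂ (inj₁ t₁x) | inj₁ t₀y = contradiction
    (trans (sym (side-T₁ x t₁x)) (trans same-side (side-T₀ y t₀y (touchesT₂-intro (sym y-at) t₂))))
    λ ()
  ... | inj₁ t₀x | inj₂ (inj₁ t₁y) = contradiction
    (trans (sym (side-T₁ y t₁y)) (trans (sym same-side) (side-T₀ x t₀x (touchesT₂-intro (sym x-at) t₂))))
    λ ()

  touched⇒¬degree-3 : ∀ {w} → touchesT₂ (base w) ≡ true → ¬ HasDegree end' w 3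
  touched⇒¬degree-3 {w} touched deg with touchesT₂-elim touched
  ... | df , df-at , t₂ = n≮n 2 (degree-≤ end' deg is-other distinguishes)
    where
      _≟ᴰ_ : (d d′ : D) → Dec (d ≡ d′)
      _≟ᴰ_ = ≡-dec _≟_ Bool._≟_
      is-other : SplitDart → Fin 2
      is-other x = if does (dart x ≟ᴰ df) then 0F else 1F
      distinguishes : ∀ {x y} → vertex x ≡ w → vertex y ≡ w → is-other x ≡ is-other y → x ≡ y
      distinguishes {x} {y} x-at y-at eq with dart x ≟ᴰ df | dart y ≟ᴰ df
      ... | yes x≡df | yes y≡df = split-dart-≡ (trans x≡df (sym y≡df)) (trans x-at (sym y-at))
      distinguishes _ _ () | yes _ | no _
      distinguishes _ _ () | no _  | yes _
      ... | no x≢df  | no y≢df  = split-dart-≡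
        (off-T₂-dart-unique {x} {y} (trans (cong base x-at) (sym df-at)) (trans (cong base y-at) (sym df-at))
          (cong side (trans x-at (sym y-at))) t₂ x≢df y≢df)
        (trans x-at (sym y-at))

  degree-2⇒touched : ∀ {w} → HasDegree end' w 2 → touchesT₂ (base w) ≡ true
  degree-2⇒touched {w} deg with touchesT₂ (base w) in eq
  ... | true  = refl
  ... | false = contradiction deg (untouched⇒¬degree-2 eq)

  degree-3⇒untouched : ∀ {w} → HasDegree end' w 3 → touchesT₂ (base w) ≡ false
  degree-3⇒untouched {w} deg with touchesT₂ (base w) in eq
  ... | true  = contradiction deg (touched⇒¬degree-3 eq)
  ... | false = refl

  -- The T₁-edges together with the copies a¹b¹ of the T₂-edges ab.
  SideOne : E' → Set
  SideOne ((e , c) , _) = μ e ≡ 1 ⊎ (μ e ≡ 2 × c ≡ true)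

  side-one⇒side : ∀ x → SideOne (proj₁ x) → side (vertex x) ≡ true
  side-one⇒side x (inj₁ t₁)        = side-T₁ x t₁
  side-one⇒side x (inj₂ (t₂ , c₁)) = trans (side-T₂ x t₂) c₁

  side⇒side-one : ∀ x → touchesT₂ (base (vertex x)) ≡ true → side (vertex x) ≡ true → SideOne (proj₁ x)
  side⇒side-one x touched on-side with μ-cases (edge x)
  ... | inj₁ t₀        = contradiction (trans (sym on-side) (side-T₀ x t₀ touched)) λ ()
  ... | inj₂ (inj₁ t₁) = inj₁ t₁
  ... | inj₂ (inj₂ t₂) = inj₂ (t₂ , trans (sym (side-T₂ x t₂)) on-side)

  side-one⇒T₁⊎T₂ : ∀ x → SideOne (proj₁ x) → μ (edge x) ≡ 1 ⊎ μ (edge x) ≡ 2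
  side-one⇒T₁⊎T₂ x (inj₁ t₁)       = inj₁ t₁
  side-one⇒T₁⊎T₂ x (inj₂ (t₂ , _)) = inj₂ t₂

  colour-along-thread : ∀ {x y} → SideOne (proj₁ x) → Thread end' x y → colour (edge x) ≡ colour (edge y)
  colour-along-thread one (arrive _) = refl
  colour-along-thread {x} one (pass z deg z-at _ thread)
    with touchesT₂-elim (degree-2⇒touched deg)
  ... | df , df-at , t₂ = trans
    (trans (colour-at-T₂-vertex (sym df-at) (side-one⇒T₁⊎T₂ x one) t₂)
           (sym (colour-at-T₂-vertex (trans (cong base z-at) (sym df-at)) (side-one⇒T₁⊎T₂ z z-one) t₂)))
    (colour-along-thread z-one thread)
    where
      z-one : SideOne (proj₁ z)
      z-one = side⇒side-one z (trans (cong (touchesT₂ ∘ base) z-at) (degree-2⇒touched deg))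
                (trans (cong side z-at) (side-one⇒side (flip end' x) one))

  colouring : SuppressedThreeEdgeColourable end'
  colouring = colour ∘ edge , constant-on-threads , injective-at-vertices
    where
      T₁-at-degree-3 : ∀ x → HasDegree end' (vertex x) 3 → μ (edge x) ≡ 1
      T₁-at-degree-3 x deg = untouched⇒T₁ (degree-3⇒untouched deg) refl
      constant-on-threads : ∀ x y → HasDegree end' (vertex x) 3 → Thread end' x y →
                            colour (edge x) ≡ colour (edge y)
      constant-on-threads x y deg = colour-along-thread (inj₁ (T₁-at-degree-3 x deg))
      injective-at-vertices : ∀ x y → HasDegree end' (vertex x) 3 → vertex x ≡ vertex y →
                              colour (edge x) ≡ colour (edge y) → x ≡ y
      injective-at-vertices x y deg same c≡c′ = split-dart-≡
        (matched-unique end (M-perfect (colour (edge x))) (cong base same)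
          (T₁-matched (T₁-at-degree-3 x deg))
          (subst (λ l → M l (edge y) ≡ true) (sym c≡c′)
            (T₁-matched (T₁-at-degree-3 y (subst (λ w → HasDegree end' w 3) same deg)))))
        same

lemma2p2 : ∀ {n m : _} (end : Fin m → Bool → Fin n) →
    Cubic end → Bridgeless end →
    (M₁ M₂ M₃ : Fin m → Bool) → FRTriple end M₁ M₂ M₃ →
    SuppressedThreeEdgeColourable (Split.end' end M₁ M₂ M₃)
lemma2p2 end cubic _ M₁ M₂ M₃ fr = colouring end cubic M₁ M₂ M₃ fr
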